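{- Let $k \ge s \ge 0$ and $p \ge 0$ be integers. Choose a path with $k$ upsteps and $s$ downsteps uniformly at random among all $\binom{k+s}{s}$ such paths. Then the probability that the path visits $m$ from above exactly $p$ times is the same for every integer $m$ with $-1 \le m \le k-s$.
   Context: A path is a finite sequence of steps, each $+1$ (upstep) or $-1$ (downstep), starting at height $0$. A path visits $m$ from above at time $r$ if its height after $r$ steps is $m$ and its $r$-th step is a downstep. -}

module Defs where

open import Data.Bool using (Bool; true; false; if_then_else_; _∧_)
open import Data.Nat using (ℕ; zero; suc; _+_; _≡ᵇ_)
open import Data.Integer using (ℤ; _-_) renaming (_+_ to _+ℤ_; +_ to pos)
import Data.Integer as ℤ
open import Data.List using (List; []; _∷_; map; _++_; length; filterᵇ)
open import Relation.Nullary.Decidable using (⌊_⌋)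

-- A step: true = upstep (+1), false = downstep (-1).
Path : Set
Path = List Bool

allPaths : ℕ → List Path
allPaths zero = [] ∷ []
allPaths (suc n) = map (true ∷_) (allPaths n) ++ map (false ∷_) (allPaths n)

ups : Path → ℕ
ups [] = 0
ups (true ∷ xs) = suc (ups xs)
ups (false ∷ xs) = ups xs

downs : Path → ℕ
downs [] = 0
downs (true ∷ xs) = downs xs
downs (false ∷ xs) = suc (downs xs)

pathsWith : ℕ → ℕ → List Path
pathsWith k s = filterᵇ (λ π → (ups π ≡ᵇ k) ∧ (downs π ≡ᵇ s)) (allPaths (k + s))

-- visitsFrom m h π : number of times r such that the height after r steps is m
-- and the r-th step is a downstep, for the path π started at height h.
visitsFrom : ℤ → ℤ → Path → ℕ
visitsFrom m h [] = 0
visitsFrom m h (true ∷ xs) = visitsFrom m (h +ℤ pos 1) xs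
visitsFrom m h (false ∷ xs) =
  (if ⌊ (h - pos 1) ℤ.≟ m ⌋ then 1 else 0) + visitsFrom m (h - pos 1) xs

visitsFromAbove : ℤ → Path → ℕ
visitsFromAbove m π = visitsFrom m (pos 0) π

-- Under the uniform distribution on pathsWith k s, the
-- probability of this event is this count divided by C(k+s,s).
countVisits : ℕ → ℕ → ℕ → ℤ → ℕ
countVisits k s p m = length (filterᵇ (λ π → visitsFromAbove m π ≡ᵇ p) (pathsWith k s))

module Submission where

-- Write N(k,s,j) for the number of paths with k upsteps and
-- s downsteps that visit the level j − 1 from above exactly p times (p is
-- fixed throughout).  For j + s ≤ k + 1 we show N(k,s,j) = N(k,s,0), by a
-- double induction comparing two decompositions of the same count:
--   * splitting on the FIRST step (for j ≥ 1): an upstep moves the target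
--     level one unit closer, a downstep (which cannot hit a level ≥ 0) one
--     unit further, so N(k+1,s+1,j+1) = N(k,s+1,j) + N(k+1,s,j+2);
--   * splitting on the LAST step (for the level −1): a final downstep ends at
--     height k − s ≥ 0, so it is never a visit of −1, and
--     N(k+1,s+1,0) = N(k,s+1,0) + N(k+1,s,0);
--   * paths without downsteps visit no level, which settles s = 0.
-- To keep the recursion in ℕ, visits are counted by 'visitsRel a b', which
-- watches the level a − b − 1 relative to the start; it agrees with the
-- integer-valued 'visitsFrom' of the statement.

open import Defs
open import Data.Nat using (ℕ; _≤_; _∸_)
open import Data.Integer using (ℤ; +_; -[1+_]) renaming (_≤_ to _≤ℤ_)
open import Relation.Binary.PropositionalEquality using (_≡_)

open import Algebra.Bundles using (AbelianGroup)
open import Data.Bool using (Bool; true; false; T; _∧_; if_then_else_)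
open import Data.Bool.Properties using (T-∧)
open import Data.Integer using (_-_; +≤+; -≤-) renaming (_+_ to _+ℤ_; _≟_ to _≟ℤ_)
open import Data.Integer.Properties using (+-0-abelianGroup; +-injective)
open import Data.Integer.Tactic.RingSolver using (solve-∀)
open import Data.List using (List; []; _∷_; _++_; _∷ʳ_; [_]; map; length; filterᵇ)
open import Data.Nat using (zero; suc; _+_; _≡ᵇ_; s≤s) renaming (_≟_ to _≟ℕ_)
open import Data.Nat.Properties
  using (+-suc; +-identityʳ; +-assoc; +-comm; +-monoˡ-≤; m∸n+n≡m; m+n≤o⇒n≤o; ≤-pred; <⇒≢; ≡ᵇ⇒≡; +-commutativeSemigroup)
open import Data.Product using (_×_; _,_; proj₂)
open import Data.Empty using (⊥)
open import Data.Unit using (tt)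
open import Function using (_∘_; Equivalence; mk⇔)
open import Relation.Nullary.Decidable using (⌊_⌋; isYes≗does; does-⇔; dec-false)
open import Relation.Binary.PropositionalEquality using (refl; sym; trans; cong; cong₂; subst; module ≡-Reasoning)

open import Algebra.Properties.CommutativeSemigroup +-commutativeSemigroup using (interchange)
open import Algebra.Properties.Group (AbelianGroup.group +-0-abelianGroup) using (∙-cancelˡ; ∙-cancelʳ)

open ≡-Reasoning

countIn : {A : Set} → (A → Bool) → List A → ℕ
countIn P [] = 0
countIn P (x ∷ xs) = if P x then suc (countIn P xs) else countIn P xs

countIn-++ : {A : Set} (P : A → Bool) (xs ys : List A) →
             countIn P (xs ++ ys) ≡ countIn P xs + countIn P ys
countIn-++ P [] ys = refl
countIn-++ P (x ∷ xs) ys with P x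
... | true  = cong suc (countIn-++ P xs ys)
... | false = countIn-++ P xs ys

countIn-map : {A B : Set} (P : B → Bool) (f : A → B) (xs : List A) →
              countIn P (map f xs) ≡ countIn (P ∘ f) xs
countIn-map P f [] = refl
countIn-map P f (x ∷ xs) with P (f x)
... | true  = cong suc (countIn-map P f xs)
... | false = countIn-map P f xs

countIn-ext : {A : Set} (P Q : A → Bool) (xs : List A) →
              (∀ x → P x ≡ Q x) → countIn P xs ≡ countIn Q xs
countIn-ext P Q [] e = refl
countIn-ext P Q (x ∷ xs) e = cong₂ (λ b n → if b then suc n else n) (e x) (countIn-ext P Q xs e)

length-filter-filter : {A : Set} (Q R : A → Bool) (xs : List A) →
                       length (filterᵇ Q (filterᵇ R xs)) ≡ countIn (λ x → R x ∧ Q x) xs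
length-filter-filter Q R [] = refl
length-filter-filter Q R (x ∷ xs) with R x
... | false = length-filter-filter Q R xs
... | true with Q x
...   | true  = cong suc (length-filter-filter Q R xs)
...   | false = length-filter-filter Q R xs

count : (Path → Bool) → ℕ → ℕ
count P n = countIn P (allPaths n)

count-ext : (P Q : Path → Bool) (n : ℕ) → (∀ π → P π ≡ Q π) → count P n ≡ count Q n
count-ext P Q n = countIn-ext P Q (allPaths n)

count-first-step : (P : Path → Bool) (n : ℕ) →
                   count P (suc n) ≡ count (P ∘ (true ∷_)) n + count (P ∘ (false ∷_)) n
count-first-step P n =
  trans (countIn-++ P (map (true ∷_) (allPaths n)) (map (false ∷_) (allPaths n)))
        (cong₂ _+_ (countIn-map P (true ∷_) (allPaths n)) (countIn-map P (false ∷_) (allPaths n)))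

-- Splitting the paths of length n + 1 according to their last step; by
-- induction, peeling off first steps, which commute with the last step.
count-last-step : (P : Path → Bool) (n : ℕ) →
                  count P (suc n) ≡ count (λ π → P (π ∷ʳ true)) n + count (λ π → P (π ∷ʳ false)) n
count-last-step P zero = count-first-step P zero
count-last-step P (suc n) = begin
  count P (suc (suc n))
    ≡⟨ count-first-step P (suc n) ⟩
  count (P ∘ (true ∷_)) (suc n) + count (P ∘ (false ∷_)) (suc n)
    ≡⟨ cong₂ _+_ (count-last-step (P ∘ (true ∷_)) n) (count-last-step (P ∘ (false ∷_)) n) ⟩
  (c true true + c true false) + (c false true + c false false)
    ≡⟨ interchange (c true true) (c true false) (c false true) (c false false) ⟩
  (c true true + c false true) + (c true false + c false false)
    ≡⟨ sym (cong₂ _+_ (count-first-step (λ π → P (π ∷ʳ true)) n)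
                      (count-first-step (λ π → P (π ∷ʳ false)) n)) ⟩
  count (λ π → P (π ∷ʳ true)) (suc n) + count (λ π → P (π ∷ʳ false)) (suc n) ∎
  where
  c : Bool → Bool → ℕ
  c x y = count (λ π → P (x ∷ (π ∷ʳ y))) n

ups-∷ʳ : (π : Path) (x : Bool) → ups (π ∷ʳ x) ≡ ups [ x ] + ups π
ups-∷ʳ [] x = sym (+-identityʳ (ups [ x ]))
ups-∷ʳ (true ∷ π) x = trans (cong suc (ups-∷ʳ π x)) (sym (+-suc (ups [ x ]) (ups π)))
ups-∷ʳ (false ∷ π) x = ups-∷ʳ π x

downs-∷ʳ : (π : Path) (x : Bool) → downs (π ∷ʳ x) ≡ downs [ x ] + downs π
downs-∷ʳ [] x = sym (+-identityʳ (downs [ x ]))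
downs-∷ʳ (true ∷ π) x = downs-∷ʳ π x
downs-∷ʳ (false ∷ π) x = trans (cong suc (downs-∷ʳ π x)) (sym (+-suc (downs [ x ]) (downs π)))

-- visitsRel a b π counts the visits from above of the level a − b − 1,
-- relative to the starting height of π.
visitsRel : ℕ → ℕ → Path → ℕ
visitsRel a b [] = 0
visitsRel a b (true ∷ π) = visitsRel a (suc b) π
visitsRel a b (false ∷ π) = (if a ≡ᵇ b then 1 else 0) + visitsRel (suc a) b π

visitsRel-shift : (a b : ℕ) (π : Path) → visitsRel (suc a) (suc b) π ≡ visitsRel a b π
visitsRel-shift a b [] = refl
visitsRel-shift a b (true ∷ π) = visitsRel-shift a (suc b) π
visitsRel-shift a b (false ∷ π) = cong (_+_ (if a ≡ᵇ b then 1 else 0)) (visitsRel-shift (suc a) b π)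

visitsRel-++ : (a b : ℕ) (π ρ : Path) →
               visitsRel a b (π ++ ρ) ≡ visitsRel a b π + visitsRel (a + downs π) (b + ups π) ρ
visitsRel-++ a b [] ρ =
  cong₂ (λ a′ b′ → visitsRel a′ b′ ρ) (sym (+-identityʳ a)) (sym (+-identityʳ b))
visitsRel-++ a b (true ∷ π) ρ =
  trans (visitsRel-++ a (suc b) π ρ)
        (cong (λ b′ → visitsRel a (suc b) π + visitsRel (a + downs π) b′ ρ) (sym (+-suc b (ups π))))
visitsRel-++ a b (false ∷ π) ρ = begin
  hit + visitsRel (suc a) b (π ++ ρ)
    ≡⟨ cong (_+_ hit) (visitsRel-++ (suc a) b π ρ) ⟩
  hit + (visitsRel (suc a) b π + visitsRel (suc a + downs π) (b + ups π) ρ)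
    ≡⟨ sym (+-assoc hit _ _) ⟩
  (hit + visitsRel (suc a) b π) + visitsRel (suc a + downs π) (b + ups π) ρ
    ≡⟨ cong (λ a′ → (hit + visitsRel (suc a) b π) + visitsRel a′ (b + ups π) ρ) (sym (+-suc a (downs π))) ⟩
  (hit + visitsRel (suc a) b π) + visitsRel (a + suc (downs π)) (b + ups π) ρ ∎
  where
  hit : ℕ
  hit = if a ≡ᵇ b then 1 else 0

visitsRel-no-downs : (a b : ℕ) (π : Path) → downs π ≡ 0 → visitsRel a b π ≡ 0
visitsRel-no-downs a b [] _ = refl
visitsRel-no-downs a b (true ∷ π) d≡0 = visitsRel-no-downs a (suc b) π d≡0
visitsRel-no-downs a b (false ∷ π) ()

-- The integer form of the relative level: from height h the level m is the
-- relative level a − b − 1 exactly when h + a = m + b + 1.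
-- A downstep followed by one more unit of a leaves h + a unchanged.
step-down : (h A : ℤ) → (h - + 1) +ℤ (+ 1 +ℤ A) ≡ h +ℤ A
step-down = solve-∀

step-up : (h A : ℤ) → (h +ℤ + 1) +ℤ A ≡ (h +ℤ A) +ℤ + 1
step-up = solve-∀

shift-right : (m B : ℤ) → (m +ℤ B) +ℤ + 1 ≡ m +ℤ (+ 1 +ℤ B)
shift-right = solve-∀

lands-on-level : (m h : ℤ) (a b : ℕ) → h +ℤ + a ≡ m +ℤ + suc b → ⌊ (h - + 1) ≟ℤ m ⌋ ≡ (a ≡ᵇ b)
lands-on-level m h a b e =
  trans (isYes≗does ((h - + 1) ≟ℤ m)) (does-⇔ (mk⇔ to from) ((h - + 1) ≟ℤ m) (a ≟ℕ b))
  where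
  to : h - + 1 ≡ m → a ≡ b
  to h-1≡m = +-injective (∙-cancelˡ h (+ a) (+ b) (begin
    h +ℤ + a                  ≡⟨ e ⟩
    m +ℤ + suc b              ≡⟨ cong (_+ℤ + suc b) (sym h-1≡m) ⟩
    (h - + 1) +ℤ + suc b      ≡⟨ step-down h (+ b) ⟩
    h +ℤ + b                  ∎))
  from : a ≡ b → h - + 1 ≡ m
  from refl = ∙-cancelʳ (+ suc a) (h - + 1) m (trans (step-down h (+ a)) e)

visitsFrom-as-visitsRel : (π : Path) (m h : ℤ) (a b : ℕ) →
                          h +ℤ + a ≡ m +ℤ + suc b → visitsFrom m h π ≡ visitsRel a b π
visitsFrom-as-visitsRel [] m h a b e = refl
visitsFrom-as-visitsRel (true ∷ π) m h a b e =
  visitsFrom-as-visitsRel π m (h +ℤ + 1) a (suc b)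
    (trans (step-up h (+ a)) (trans (cong (_+ℤ + 1) e) (shift-right m (+ suc b))))
visitsFrom-as-visitsRel (false ∷ π) m h a b e =
  cong₂ _+_ (cong (λ c → if c then 1 else 0) (lands-on-level m h a b e))
            (visitsFrom-as-visitsRel π m (h - + 1) (suc a) b (trans (step-down h (+ a)) e))

hasShape : ℕ → ℕ → Path → Bool
hasShape k s π = (ups π ≡ᵇ k) ∧ (downs π ≡ᵇ s)

shape-facts : (k s : ℕ) (π : Path) → T (hasShape k s π) → ups π ≡ k × downs π ≡ s
shape-facts k s π t with Equivalence.to T-∧ t
... | u , d = ≡ᵇ⇒≡ (ups π) k u , ≡ᵇ⇒≡ (downs π) s d

∧-cong-guarded : (c : Bool) {x y : Bool} → (T c → x ≡ y) → c ∧ x ≡ c ∧ y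
∧-cong-guarded true  x≡y = x≡y tt
∧-cong-guarded false x≡y = refl

visitTest : ℕ → ℕ → ℕ → ℕ → Path → Bool
visitTest k s j p π = hasShape k s π ∧ (visitsRel j 0 π ≡ᵇ p)

visitCount : ℕ → ℕ → ℕ → ℕ → ℕ
visitCount k s j p = count (visitTest k s j p) (k + s)

-- First-step recursion for a level j ≥ 0: a first downstep is never a visit.
visitCount-first-step : (k s j p : ℕ) →
  visitCount (suc k) (suc s) (suc j) p ≡ visitCount k (suc s) j p + visitCount (suc k) s (suc (suc j)) p
visitCount-first-step k s j p = begin
  visitCount (suc k) (suc s) (suc j) p
    ≡⟨ count-first-step (visitTest (suc k) (suc s) (suc j) p) (k + suc s) ⟩
  count (visitTest (suc k) (suc s) (suc j) p ∘ (true ∷_)) (k + suc s)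
    + count (visitTest (suc k) (suc s) (suc j) p ∘ (false ∷_)) (k + suc s)
    ≡⟨ cong₂ _+_ (count-ext _ (visitTest k (suc s) j p) (k + suc s) after-up)
                 (cong (count (visitTest (suc k) s (suc (suc j)) p)) (+-suc k s)) ⟩
  visitCount k (suc s) j p + visitCount (suc k) s (suc (suc j)) p ∎
  where
  after-up : ∀ π → visitTest (suc k) (suc s) (suc j) p (true ∷ π) ≡ visitTest k (suc s) j p π
  after-up π = cong (λ v → hasShape k (suc s) π ∧ (v ≡ᵇ p)) (visitsRel-shift j 0 π)

-- Last-step recursion for the level −1: when s ≤ k a final downstep ends at
-- height k − s ≥ 0, so it is never a visit of −1.
visitCount-last-step : (k s p : ℕ) → s ≤ k →
  visitCount (suc k) (suc s) 0 p ≡ visitCount k (suc s) 0 p + visitCount (suc k) s 0 p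
visitCount-last-step k s p s≤k = begin
  visitCount (suc k) (suc s) 0 p
    ≡⟨ count-last-step (visitTest (suc k) (suc s) 0 p) (k + suc s) ⟩
  count (λ π → visitTest (suc k) (suc s) 0 p (π ∷ʳ true)) (k + suc s)
    + count (λ π → visitTest (suc k) (suc s) 0 p (π ∷ʳ false)) (k + suc s)
    ≡⟨ cong₂ _+_ (count-ext _ (visitTest k (suc s) 0 p) (k + suc s) ends-up)
                 (trans (count-ext _ (visitTest (suc k) s 0 p) (k + suc s) ends-down)
                        (cong (count (visitTest (suc k) s 0 p)) (+-suc k s))) ⟩
  visitCount k (suc s) 0 p + visitCount (suc k) s 0 p ∎
  where
  shape-∷ʳ : ∀ k′ s′ π x → hasShape k′ s′ (π ∷ʳ x) ≡ ((ups [ x ] + ups π) ≡ᵇ k′) ∧ ((downs [ x ] + downs π) ≡ᵇ s′)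
  shape-∷ʳ k′ s′ π x = cong₂ (λ u d → (u ≡ᵇ k′) ∧ (d ≡ᵇ s′)) (ups-∷ʳ π x) (downs-∷ʳ π x)

  ends-up : ∀ π → visitTest (suc k) (suc s) 0 p (π ∷ʳ true) ≡ visitTest k (suc s) 0 p π
  ends-up π = cong₂ (λ b v → b ∧ (v ≡ᵇ p)) (shape-∷ʳ (suc k) (suc s) π true)
                    (trans (visitsRel-++ 0 0 π [ true ]) (+-identityʳ (visitsRel 0 0 π)))

  final-down-misses : ∀ π → T (hasShape (suc k) s π) → visitsRel 0 0 (π ∷ʳ false) ≡ visitsRel 0 0 π
  final-down-misses π t with shape-facts (suc k) s π t
  ... | u≡ , d≡ = begin
    visitsRel 0 0 (π ∷ʳ false)
      ≡⟨ visitsRel-++ 0 0 π [ false ] ⟩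
    visitsRel 0 0 π + ((if downs π ≡ᵇ ups π then 1 else 0) + 0)
      ≡⟨ cong (λ c → visitsRel 0 0 π + ((if c then 1 else 0) + 0)) (dec-false (downs π ≟ℕ ups π) d≢u) ⟩
    visitsRel 0 0 π + 0
      ≡⟨ +-identityʳ (visitsRel 0 0 π) ⟩
    visitsRel 0 0 π ∎
    where
    d≢u : downs π ≡ ups π → ⊥
    d≢u d≡u = <⇒≢ (s≤s s≤k) (trans (sym d≡) (trans d≡u u≡))

  ends-down : ∀ π → visitTest (suc k) (suc s) 0 p (π ∷ʳ false) ≡ visitTest (suc k) s 0 p π
  ends-down π = trans (cong (_∧ (visitsRel 0 0 (π ∷ʳ false) ≡ᵇ p)) (shape-∷ʳ (suc k) (suc s) π false))
                      (∧-cong-guarded (hasShape (suc k) s π) (cong (_≡ᵇ p) ∘ final-down-misses π))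

visitCount-no-downsteps : (k j p : ℕ) → visitCount k 0 j p ≡ visitCount k 0 0 p
visitCount-no-downsteps k j p = count-ext _ _ (k + 0) λ π →
  ∧-cong-guarded (hasShape k 0 π) λ t →
    let d≡0 = proj₂ (shape-facts k 0 π t) in
    cong (_≡ᵇ p) (trans (visitsRel-no-downs j 0 π d≡0) (sym (visitsRel-no-downs 0 0 π d≡0)))

visitCount-level-invariant : (k s j p : ℕ) → j + s ≤ suc k → visitCount k s j p ≡ visitCount k s 0 p
visitCount-level-invariant k s zero p _ = refl
visitCount-level-invariant k zero (suc j) p _ = visitCount-no-downsteps k (suc j) p
visitCount-level-invariant zero (suc s) (suc j) p (s≤s j+s≤0) with m+n≤o⇒n≤o j j+s≤0
... | ()
visitCount-level-invariant (suc k) (suc s) (suc j) p (s≤s j+s≤k) = begin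
  visitCount (suc k) (suc s) (suc j) p
    ≡⟨ visitCount-first-step k s j p ⟩
  visitCount k (suc s) j p + visitCount (suc k) s (suc (suc j)) p
    ≡⟨ cong₂ _+_ (visitCount-level-invariant k (suc s) j p j+s≤k)
                 (visitCount-level-invariant (suc k) s (suc (suc j)) p (s≤s (subst (_≤ suc k) (+-suc j s) j+s≤k))) ⟩
  visitCount k (suc s) 0 p + visitCount (suc k) s 0 p
    ≡⟨ sym (visitCount-last-step k s p (≤-pred (m+n≤o⇒n≤o j j+s≤k))) ⟩
  visitCount (suc k) (suc s) 0 p ∎

countVisits-as-visitCount : (k s p : ℕ) (m : ℤ) (a : ℕ) → + a ≡ m +ℤ + 1 →
                            countVisits k s p m ≡ visitCount k s a p
countVisits-as-visitCount k s p m a e =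
  trans (length-filter-filter (λ π → visitsFromAbove m π ≡ᵇ p) (hasShape k s) (allPaths (k + s)))
        (count-ext _ _ (k + s) λ π →
          cong (λ v → hasShape k s π ∧ (v ≡ᵇ p)) (visitsFrom-as-visitsRel π m (+ 0) a 0 e))

countVisits-in-range : (k s p : ℕ) → s ≤ k → (m : ℤ) → -[1+ 0 ] ≤ℤ m → m ≤ℤ + (k ∸ s) →
                       countVisits k s p m ≡ visitCount k s 0 p
countVisits-in-range k s p s≤k -[1+ zero ] _ _ = countVisits-as-visitCount k s p -[1+ 0 ] 0 refl
countVisits-in-range k s p s≤k -[1+ suc n ] (-≤- ()) _
countVisits-in-range k s p s≤k (+ j) _ (+≤+ j≤k∸s) =
  trans (countVisits-as-visitCount k s p (+ j) (suc j) (cong +_ (+-comm 1 j)))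
        (visitCount-level-invariant k s (suc j) p
          (s≤s (subst (j + s ≤_) (m∸n+n≡m s≤k) (+-monoˡ-≤ s j≤k∸s))))

lemma2 : (k s p : ℕ) → s ≤ k → (m m′ : ℤ) →
           -[1+ 0 ] ≤ℤ m → m ≤ℤ + (k ∸ s) →
           -[1+ 0 ] ≤ℤ m′ → m′ ≤ℤ + (k ∸ s) →
           countVisits k s p m ≡ countVisits k s p m′
lemma2 k s p s≤k m m′ -1≤m m≤k-s -1≤m′ m′≤k-s =
  trans (countVisits-in-range k s p s≤k m -1≤m m≤k-s)
        (sym (countVisits-in-range k s p s≤k m′ -1≤m′ m′≤k-s))
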